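{- Let $G$ be a finite simple graph with $\Delta(G)\le 3$, and let $(V_1,V_2)$ be a maximum cut of $G$ which, among all maximum cuts, minimises $|V_1|$. Then: (1) $\Delta(G[V_1])\le 1$ and $\Delta(G[V_2])\le 1$; (2) for every edge $uv\in E(G[V_1])\cup E(G[V_2])$, we have $d_G(u)\ge 2$ and $d_G(v)\ge 2$; (3) for every edge $uv\in E(G[V_1])$, we have $d_G(u)=d_G(v)=3$.
   Context: A cut of $G$ is a partition $(V_1,V_2)$ of $V(G)$; it is maximum if the number of edges with one end in $V_1$ and the other in $V_2$ is maximum over all cuts. $G[V_i]$ denotes the subgraph induced by $V_i$, and $d_G(u)$ the degree of $u$ in $G$. -}

module Defs where

open import Data.Nat using (ℕ; _+_; _<ᵇ_; _≤_)
open import Data.Bool using (Bool; true; false; if_then_else_; _∧_; not)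
open import Data.Bool.Properties using () renaming (_≟_ to _≟ᵇ_)
open import Data.Fin using (Fin; toℕ)
open import Data.List using (List; map)
open import Data.Nat.ListAction using (sum)
open import Data.Product using (_×_)
open import Data.List using () renaming (allFin to allFinL)
open import Relation.Binary.PropositionalEquality using (_≡_)
open import Relation.Nullary.Decidable using (⌊_⌋)

record Graph (n : ℕ) : Set where
  field
    adj    : Fin n → Fin n → Bool
    sym    : ∀ u v → adj u v ≡ adj v u
    irrefl : ∀ u → adj u u ≡ false
open Graph public

count : {n : ℕ} → (Fin n → Bool) → ℕ
count {n} p = sum (map (λ i → if p i then 1 else 0) (allFinL n))

-- a cut (V₁ , V₂) is given by its side function: true = V₁, false = V₂
Cut : ℕ → Set
Cut n = Fin n → Bool

size₁ : {n : ℕ} → Cut n → ℕ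
size₁ S = count S

deg : {n : ℕ} → Graph n → Fin n → ℕ
deg G u = count (λ v → adj G u v)

MaxDeg≤ : {n : ℕ} → Graph n → ℕ → Set
MaxDeg≤ G k = ∀ u → deg G u ≤ k

degSide : {n : ℕ} → Graph n → Cut n → Fin n → ℕ
degSide G S u = count (λ v → adj G u v ∧ ⌊ S v ≟ᵇ S u ⌋)

cutSize : {n : ℕ} → Graph n → Cut n → ℕ
cutSize {n} G S =
  sum (map (λ u → count (λ v → (toℕ u <ᵇ toℕ v) ∧ adj G u v ∧ not ⌊ S u ≟ᵇ S v ⌋))
           (allFinL n))

IsMaxCut : {n : ℕ} → Graph n → Cut n → Set
IsMaxCut G S = ∀ (S' : Cut _) → cutSize G S' ≤ cutSize G S

IsMinMaxCut : {n : ℕ} → Graph n → Cut n → Set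
IsMinMaxCut G S = IsMaxCut G S × (∀ (S' : Cut _) → IsMaxCut G S' → size₁ S ≤ size₁ S')

{-# OPTIONS --safe #-}
module Submission where

-- Write d⁺(w) and d⁻(w) for the numbers of neighbours of w on its own side of a
-- cut and across it. Moving w to the other side changes the cut size by
-- d⁺(w) − d⁻(w), so in a maximum cut d⁺ ≤ d⁻ everywhere; together with
-- d⁺ + d⁻ = d ≤ 3 this gives d⁺ ≤ 1, and an edge inside a side gives d⁺ ≥ 1,
-- hence d ≥ 2. If a vertex w of V₁ had d⁺(w) = d⁻(w), moving it would give a
-- maximum cut with a smaller V₁; so an edge inside V₁ forces d⁻ ≥ 2 and d = 3.

open import Data.Bool.Base using (Bool; true; false; if_then_else_; _∧_; _∨_; not)
open import Data.Bool.Properties using () renaming (_≟_ to _≟ᵇ_)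
open import Data.Fin.Base using (Fin; zero; suc; toℕ)
open import Data.Fin.Properties using (_≟_; toℕ-injective)
open import Data.List.Base using (map; tabulate; allFin)
open import Data.List.Properties using (map-tabulate)
open import Data.Nat.Base using (ℕ; zero; suc; _+_; _≤_; _<_; _<ᵇ_; z≤n; s≤s)
import Data.Nat.ListAction as List
open import Data.Nat.Properties
  using ( +-0-commutativeMonoid; +-identityʳ; +-comm; +-cancelʳ-≡; +-cancelˡ-≤; +-mono-≤
        ; +-monoˡ-≤; +-monoʳ-≤; ≤-trans; ≤-antisym; ≤-reflexive; <-asym; ≤∧≢⇒<; ≮⇒≥; 1+n≰n
        ; m≤m+n; m≤n+m; <ᵇ-reflects-<; module ≤-Reasoning)
open import Algebra.Properties.CommutativeMonoid.Sum +-0-commutativeMonoid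
  using (sum; sum-syntax; sum-cong-≗; ∑-distrib-+; sum-replicate-zero)
open import Data.Product.Base using (_×_; _,_)
open import Data.Vec.Functional.Properties using (updateAt-updates; updateAt-minimal)
open import Data.Vec.Functional using (updateAt)
open import Defs renaming (sym to adj-sym; irrefl to adj-irrefl)
open import Function.Base using (id; _∘_)
open import Relation.Binary.PropositionalEquality
  using (_≡_; _≢_; refl; sym; trans; cong; cong₂; subst; module ≡-Reasoning)
open import Relation.Nullary.Decidable using (⌊_⌋; does; yes; no)
open import Relation.Nullary.Negation using (contradiction)
open import Relation.Nullary.Reflects using (ofʸ; ofⁿ)

sum-tabulate : ∀ {n} (f : Fin n → ℕ) → List.sum (tabulate f) ≡ sum f
sum-tabulate {zero}  f = refl
sum-tabulate {suc n} f = cong (f zero +_) (sum-tabulate (f ∘ suc))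

sum-allFin : ∀ {n} (f : Fin n → ℕ) → List.sum (map f (allFin n)) ≡ sum f
sum-allFin f = trans (cong List.sum (map-tabulate id f)) (sum-tabulate f)

term≤sum : ∀ {n} (f : Fin n → ℕ) i → f i ≤ sum f
term≤sum f zero    = m≤m+n _ _
term≤sum f (suc i) = ≤-trans (term≤sum (f ∘ suc) i) (m≤n+m _ _)

-- Fin equality is tested with `does` rather than `⌊_⌋`: only the former makes
-- `does (suc u ≟ suc w)` reduce to `does (u ≟ w)`.
sum-at : ∀ {n} (w : Fin n) (f : Fin n → ℕ) → ∑[ u < n ] (if does (u ≟ w) then f u else 0) ≡ f w
sum-at {suc n} zero    f = trans (cong (f zero +_) (sum-replicate-zero n)) (+-identityʳ _)
sum-at {suc n} (suc w) f = sum-at {n} w (f ∘ suc)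

sum-if : ∀ {n} b (f : Fin n → ℕ) → ∑[ i < n ] (if b then f i else 0) ≡ (if b then sum f else 0)
sum-if     true  f = refl
sum-if {n} false f = sum-replicate-zero n

∑∑-distrib-+ : ∀ {m n} (f g : Fin m → Fin n → ℕ) →
  ∑[ u < m ] ∑[ v < n ] (f u v + g u v) ≡ ∑[ u < m ] ∑[ v < n ] f u v + ∑[ u < m ] ∑[ v < n ] g u v
∑∑-distrib-+ {n = n} f g = trans (sum-cong-≗ (λ u → ∑-distrib-+ (f u) (g u)))
                                 (∑-distrib-+ (λ u → ∑[ v < n ] f u v) (λ u → ∑[ v < n ] g u v))

[_] : Bool → ℕ
[ b ] = if b then 1 else 0

count≡∑ : ∀ {n} (p : Fin n → Bool) → count p ≡ ∑[ i < n ] [ p i ]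
count≡∑ p = sum-allFin ([_] ∘ p)

count-cong : ∀ {n} {p q : Fin n → Bool} → (∀ i → p i ≡ q i) → count p ≡ count q
count-cong {p = p} {q} p≗q = begin
  count p               ≡⟨ count≡∑ p ⟩
  sum (λ i → [ p i ])   ≡⟨ sum-cong-≗ (cong [_] ∘ p≗q) ⟩
  sum (λ i → [ q i ])   ≡⟨ count≡∑ q ⟨
  count q               ∎
  where open ≡-Reasoning

count-∧-split : ∀ {n} (p q : Fin n → Bool) →
  count p ≡ count (λ i → p i ∧ q i) + count (λ i → p i ∧ not (q i))
count-∧-split p q = begin
  count p
    ≡⟨ count≡∑ p ⟩
  sum (λ i → [ p i ])
    ≡⟨ sum-cong-≗ (λ i → split (p i) (q i)) ⟩
  sum (λ i → [ p i ∧ q i ] + [ p i ∧ not (q i) ])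
    ≡⟨ ∑-distrib-+ (λ i → [ p i ∧ q i ]) (λ i → [ p i ∧ not (q i) ]) ⟩
  sum (λ i → [ p i ∧ q i ]) + sum (λ i → [ p i ∧ not (q i) ])
    ≡⟨ cong₂ _+_ (count≡∑ (λ i → p i ∧ q i)) (count≡∑ (λ i → p i ∧ not (q i))) ⟨
  count (λ i → p i ∧ q i) + count (λ i → p i ∧ not (q i)) ∎
  where
  open ≡-Reasoning
  split : ∀ a b → [ a ] ≡ [ a ∧ b ] + [ a ∧ not b ]
  split false _     = refl
  split true  false = refl
  split true  true  = refl

count>0 : ∀ {n} (p : Fin n → Bool) i → p i ≡ true → 0 < count p
count>0 p i pᵢ = begin
  1               ≡⟨ cong [_] pᵢ ⟨
  [ p i ]         ≤⟨ term≤sum ([_] ∘ p) i ⟩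
  sum ([_] ∘ p)   ≡⟨ count≡∑ p ⟨
  count p         ∎
  where open ≤-Reasoning

≟ᵇ-refl : ∀ a → ⌊ a ≟ᵇ a ⌋ ≡ true
≟ᵇ-refl false = refl
≟ᵇ-refl true  = refl

≟ᵇ-sym : ∀ a b → ⌊ a ≟ᵇ b ⌋ ≡ ⌊ b ≟ᵇ a ⌋
≟ᵇ-sym false false = refl
≟ᵇ-sym false true  = refl
≟ᵇ-sym true  false = refl
≟ᵇ-sym true  true  = refl

not-≟ᵇ-not : ∀ a b → not ⌊ not a ≟ᵇ b ⌋ ≡ ⌊ b ≟ᵇ a ⌋
not-≟ᵇ-not false false = refl
not-≟ᵇ-not false true  = refl
not-≟ᵇ-not true  false = refl
not-≟ᵇ-not true  true  = refl

m+m≤3⇒m≤1 : ∀ {m} → m + m ≤ 3 → m ≤ 1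
m+m≤3⇒m≤1 {0}           _ = z≤n
m+m≤3⇒m≤1 {1}           _ = s≤s z≤n
m+m≤3⇒m≤1 {suc (suc m)} (s≤s (s≤s m+2+m≤1)) with ≤-trans (m≤n+m (suc (suc m)) m) m+2+m≤1
... | s≤s ()

module _ {n : ℕ} where

  ordered : Graph n → Fin n → Fin n → ℕ
  ordered H u v = [ (toℕ u <ᵇ toℕ v) ∧ adj H u v ]

  edgeCount : Graph n → ℕ
  edgeCount H = ∑[ u < n ] ∑[ v < n ] ordered H u v

  ordered-irrefl : ∀ H u → ordered H u u ≡ 0
  ordered-irrefl H u with toℕ u <ᵇ toℕ u
  ... | false = refl
  ... | true  = cong [_] (adj-irrefl H u)

  ordered+ordered≡adj : ∀ H u v → ordered H u v + ordered H v u ≡ [ adj H u v ]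
  ordered+ordered≡adj H u v
    with toℕ u <ᵇ toℕ v | <ᵇ-reflects-< (toℕ u) (toℕ v)
       | toℕ v <ᵇ toℕ u | <ᵇ-reflects-< (toℕ v) (toℕ u)
  ... | true  | ofʸ u<v | true  | ofʸ v<u = contradiction v<u (<-asym u<v)
  ... | true  | _       | false | _       = +-identityʳ _
  ... | false | _       | true  | _       = cong [_] (adj-sym H v u)
  ... | false | ofⁿ u≮v | false | ofⁿ v≮u =
    sym (cong [_] (trans (cong (adj H u) (sym u≡v)) (adj-irrefl H u)))
    where u≡v = toℕ-injective (≤-antisym (≮⇒≥ v≮u) (≮⇒≥ u≮v))

  touching : Fin n → Graph n → Fin n → Fin n → ℕ
  touching w H u v = if does (u ≟ w) ∨ does (v ≟ w) then ordered H u v else 0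

  sum-touching≡deg : ∀ H w → ∑[ u < n ] ∑[ v < n ] touching w H u v ≡ deg H w
  sum-touching≡deg H w = begin
      ∑[ u < n ] ∑[ v < n ] touching w H u v
    ≡⟨ sum-cong-≗ (λ u → sum-cong-≗ (split u)) ⟩
      ∑[ u < n ] ∑[ v < n ] (rowAt u v + columnAt u v)
    ≡⟨ ∑∑-distrib-+ rowAt columnAt ⟩
      ∑[ u < n ] ∑[ v < n ] rowAt u v + ∑[ u < n ] ∑[ v < n ] columnAt u v
    ≡⟨ cong₂ _+_ (sum-cong-≗ (λ u → sum-if (does (u ≟ w)) (ordered H u)))
                 (sum-cong-≗ (λ u → sum-at w (ordered H u))) ⟩
      ∑[ u < n ] (if does (u ≟ w) then ∑[ v < n ] ordered H u v else 0) + ∑[ u < n ] ordered H u w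
    ≡⟨ cong (_+ ∑[ u < n ] ordered H u w) (sum-at w (λ u → ∑[ v < n ] ordered H u v)) ⟩
      ∑[ v < n ] ordered H w v + ∑[ v < n ] ordered H v w
    ≡⟨ ∑-distrib-+ (ordered H w) (λ v → ordered H v w) ⟨
      ∑[ v < n ] (ordered H w v + ordered H v w)
    ≡⟨ sum-cong-≗ (ordered+ordered≡adj H w) ⟩
      ∑[ v < n ] [ adj H w v ]
    ≡⟨ count≡∑ (adj H w) ⟨
      deg H w ∎
    where
    open ≡-Reasoning
    rowAt columnAt : Fin n → Fin n → ℕ
    rowAt    u v = if does (u ≟ w) then ordered H u v else 0
    columnAt u v = if does (v ≟ w) then ordered H u v else 0
    split : ∀ u v → touching w H u v ≡ rowAt u v + columnAt u v
    split u v with u ≟ w | v ≟ w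
    ... | yes refl | yes refl rewrite ordered-irrefl H u = refl
    ... | yes _    | no _     = sym (+-identityʳ _)
    ... | no _     | _        = refl

  edgeCount-agree-off : ∀ H H' w → (∀ u v → u ≢ w → v ≢ w → adj H u v ≡ adj H' u v) →
    edgeCount H + deg H' w ≡ edgeCount H' + deg H w
  edgeCount-agree-off H H' w agree = begin
      edgeCount H + deg H' w
    ≡⟨ cong (edgeCount H +_) (sum-touching≡deg H' w) ⟨
      ∑[ u < n ] ∑[ v < n ] ordered H u v + ∑[ u < n ] ∑[ v < n ] touching w H' u v
    ≡⟨ ∑∑-distrib-+ (ordered H) (touching w H') ⟨
      ∑[ u < n ] ∑[ v < n ] (ordered H u v + touching w H' u v)
    ≡⟨ sum-cong-≗ (λ u → sum-cong-≗ (exchange u)) ⟩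
      ∑[ u < n ] ∑[ v < n ] (ordered H' u v + touching w H u v)
    ≡⟨ ∑∑-distrib-+ (ordered H') (touching w H) ⟩
      ∑[ u < n ] ∑[ v < n ] ordered H' u v + ∑[ u < n ] ∑[ v < n ] touching w H u v
    ≡⟨ cong (edgeCount H' +_) (sum-touching≡deg H w) ⟩
      edgeCount H' + deg H w ∎
    where
    open ≡-Reasoning
    exchange : ∀ u v → ordered H u v + touching w H' u v ≡ ordered H' u v + touching w H u v
    exchange u v with u ≟ w | v ≟ w
    ... | yes _   | _       = +-comm (ordered H u v) (ordered H' u v)
    ... | no _    | yes _   = +-comm (ordered H u v) (ordered H' u v)
    ... | no u≢w | no v≢w =
      cong (λ b → [ (toℕ u <ᵇ toℕ v) ∧ b ] + 0) (agree u v u≢w v≢w)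

module _ {n : ℕ} (G : Graph n) where

  crossing : Cut n → Graph n
  crossing S = record
    { adj    = λ u v → adj G u v ∧ not ⌊ S u ≟ᵇ S v ⌋
    ; sym    = λ u v → cong₂ (λ a b → a ∧ not b) (adj-sym G u v) (≟ᵇ-sym (S u) (S v))
    ; irrefl = λ u → cong (_∧ not ⌊ S u ≟ᵇ S u ⌋) (adj-irrefl G u)
    }

  flipAt : Cut n → Fin n → Cut n
  flipAt S w = updateAt S w not

  cutSize≡edgeCount-crossing : ∀ S → cutSize G S ≡ edgeCount (crossing S)
  cutSize≡edgeCount-crossing S =
    trans (sum-allFin (λ u → count (edgeFrom u))) (sum-cong-≗ (count≡∑ ∘ edgeFrom))
    where
    edgeFrom : Fin n → Fin n → Bool
    edgeFrom u v = (toℕ u <ᵇ toℕ v) ∧ adj (crossing S) u v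

  deg≡degSide+deg-crossing : ∀ S w → deg G w ≡ degSide G S w + deg (crossing S) w
  deg≡degSide+deg-crossing S w =
    trans (count-∧-split (adj G w) (λ v → ⌊ S v ≟ᵇ S w ⌋))
          (cong (degSide G S w +_)
                (count-cong (λ v → cong (λ b → adj G w v ∧ not b) (≟ᵇ-sym (S v) (S w)))))

  crossing-flipAt-off : ∀ S w u v → u ≢ w → v ≢ w →
    adj (crossing (flipAt S w)) u v ≡ adj (crossing S) u v
  crossing-flipAt-off S w u v u≢w v≢w =
    cong₂ (λ a b → adj G u v ∧ not ⌊ a ≟ᵇ b ⌋)
          (updateAt-minimal u w S u≢w) (updateAt-minimal v w S v≢w)

  deg-crossing-flipAt : ∀ S w → deg (crossing (flipAt S w)) w ≡ degSide G S w
  deg-crossing-flipAt S w = count-cong pointwise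
    where
    pointwise : ∀ v → adj (crossing (flipAt S w)) w v ≡ adj G w v ∧ ⌊ S v ≟ᵇ S w ⌋
    pointwise v with v ≟ w
    ... | yes refl rewrite adj-irrefl G v = refl
    ... | no v≢w rewrite updateAt-updates w {not} S | updateAt-minimal v w {not} S v≢w =
      cong (adj G w v ∧_) (not-≟ᵇ-not (S w) (S v))

  size₁-flipAt : ∀ S w → S w ≡ true → size₁ S ≡ suc (size₁ (flipAt S w))
  size₁-flipAt S w Sw = begin
      size₁ S
    ≡⟨ count≡∑ S ⟩
      ∑[ u < n ] [ S u ]
    ≡⟨ sum-cong-≗ pointwise ⟩
      ∑[ u < n ] ([ flipAt S w u ] + (if does (u ≟ w) then 1 else 0))
    ≡⟨ ∑-distrib-+ (λ u → [ flipAt S w u ]) (λ u → if does (u ≟ w) then 1 else 0) ⟩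
      ∑[ u < n ] [ flipAt S w u ] + ∑[ u < n ] (if does (u ≟ w) then 1 else 0)
    ≡⟨ cong₂ _+_ (sym (count≡∑ (flipAt S w))) (sum-at w (λ _ → 1)) ⟩
      size₁ (flipAt S w) + 1
    ≡⟨ +-comm (size₁ (flipAt S w)) 1 ⟩
      suc (size₁ (flipAt S w)) ∎
    where
    open ≡-Reasoning
    pointwise : ∀ u → [ S u ] ≡ [ flipAt S w u ] + (if does (u ≟ w) then 1 else 0)
    pointwise u with u ≟ w
    ... | yes refl rewrite updateAt-updates u {not} S | Sw = refl
    ... | no u≢w   rewrite updateAt-minimal u w {not} S u≢w = sym (+-identityʳ _)

  cutSize-flipAt : ∀ S w →
    cutSize G (flipAt S w) + deg (crossing S) w ≡ cutSize G S + degSide G S w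
  cutSize-flipAt S w = begin
      cutSize G (flipAt S w) + deg (crossing S) w
    ≡⟨ cong (_+ deg (crossing S) w) (cutSize≡edgeCount-crossing (flipAt S w)) ⟩
      edgeCount (crossing (flipAt S w)) + deg (crossing S) w
    ≡⟨ edgeCount-agree-off (crossing (flipAt S w)) (crossing S) w (crossing-flipAt-off S w) ⟩
      edgeCount (crossing S) + deg (crossing (flipAt S w)) w
    ≡⟨ cong₂ _+_ (sym (cutSize≡edgeCount-crossing S)) (deg-crossing-flipAt S w) ⟩
      cutSize G S + degSide G S w ∎
    where open ≡-Reasoning

  maxCut⇒degSide≤deg-crossing : ∀ {S} → IsMaxCut G S → ∀ w → degSide G S w ≤ deg (crossing S) w
  maxCut⇒degSide≤deg-crossing {S} max w = +-cancelˡ-≤ (cutSize G S) _ _ (begin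
      cutSize G S + degSide G S w                    ≡⟨ cutSize-flipAt S w ⟨
      cutSize G (flipAt S w) + deg (crossing S) w    ≤⟨ +-monoˡ-≤ _ (max (flipAt S w)) ⟩
      cutSize G S + deg (crossing S) w               ∎)
    where open ≤-Reasoning

  maxCut-flipAt : ∀ {S} w → IsMaxCut G S → degSide G S w ≡ deg (crossing S) w →
    IsMaxCut G (flipAt S w)
  maxCut-flipAt {S} w max balanced S′ = ≤-trans (max S′) (≤-reflexive (sym unchanged))
    where
    unchanged : cutSize G (flipAt S w) ≡ cutSize G S
    unchanged = +-cancelʳ-≡ (deg (crossing S) w) _ _
      (trans (cutSize-flipAt S w) (cong (cutSize G S +_) balanced))

  minMaxCut⇒degSide<deg-crossing : ∀ {S} → IsMinMaxCut G S → ∀ w → S w ≡ true →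
    degSide G S w < deg (crossing S) w
  minMaxCut⇒degSide<deg-crossing {S} (max , min) w Sw =
    ≤∧≢⇒< (maxCut⇒degSide≤deg-crossing max w) λ balanced →
      1+n≰n (subst (_≤ size₁ (flipAt S w)) (size₁-flipAt S w Sw)
                   (min (flipAt S w) (maxCut-flipAt w max balanced)))

  1≤degSide : ∀ S {u v} → adj G u v ≡ true → S u ≡ S v → 1 ≤ degSide G S u
  1≤degSide S {u} {v} uv Su≡Sv = count>0 (λ x → adj G u x ∧ ⌊ S x ≟ᵇ S u ⌋) v sameSide
    where
    sameSide : adj G u v ∧ ⌊ S v ≟ᵇ S u ⌋ ≡ true
    sameSide rewrite uv | Su≡Sv = ≟ᵇ-refl (S v)

  degSide≤1 : MaxDeg≤ G 3 → ∀ {S} → IsMaxCut G S → ∀ u → degSide G S u ≤ 1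
  degSide≤1 Δ≤3 {S} max u = m+m≤3⇒m≤1 (begin
    degSide G S u + degSide G S u        ≤⟨ +-monoʳ-≤ _ (maxCut⇒degSide≤deg-crossing max u) ⟩
    degSide G S u + deg (crossing S) u   ≡⟨ deg≡degSide+deg-crossing S u ⟨
    deg G u                              ≤⟨ Δ≤3 u ⟩
    3                                    ∎)
    where open ≤-Reasoning

  maxCut⇒2≤deg : ∀ {S} → IsMaxCut G S → ∀ {u v} → adj G u v ≡ true → S u ≡ S v → 2 ≤ deg G u
  maxCut⇒2≤deg {S} max {u} uv Su≡Sv = subst (2 ≤_) (sym (deg≡degSide+deg-crossing S u))
    (+-mono-≤ 1≤s (≤-trans 1≤s (maxCut⇒degSide≤deg-crossing max u)))
    where 1≤s = 1≤degSide S uv Su≡Sv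

  minMaxCut⇒3≤deg : ∀ {S} → IsMinMaxCut G S → ∀ {u v} → adj G u v ≡ true →
    S u ≡ true → S v ≡ true → 3 ≤ deg G u
  minMaxCut⇒3≤deg {S} minMax {u} uv Su Sv = subst (3 ≤_) (sym (deg≡degSide+deg-crossing S u))
    (+-mono-≤ 1≤s (≤-trans (s≤s 1≤s) (minMaxCut⇒degSide<deg-crossing minMax u Su)))
    where 1≤s = 1≤degSide S uv (trans Su (sym Sv))

lemma3p1 : (n : ℕ) (G : Graph n) → MaxDeg≤ G 3 →
    (S : Cut n) → IsMinMaxCut G S →
    ((∀ u → S u ≡ true → degSide G S u ≤ 1) × (∀ u → S u ≡ false → degSide G S u ≤ 1))
    × (∀ u v → adj G u v ≡ true → S u ≡ S v → (2 ≤ deg G u) × (2 ≤ deg G v))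
    × (∀ u v → adj G u v ≡ true → S u ≡ true → S v ≡ true → (deg G u ≡ 3) × (deg G v ≡ 3))
lemma3p1 n G Δ≤3 S minMax@(max , _) =
    ((λ u _ → degSide≤1 G Δ≤3 max u) , (λ u _ → degSide≤1 G Δ≤3 max u))
  , (λ u v uv Su≡Sv → maxCut⇒2≤deg G max uv Su≡Sv , maxCut⇒2≤deg G max (reversed uv) (sym Su≡Sv))
  , (λ u v uv Su Sv → deg≡3 uv Su Sv , deg≡3 (reversed uv) Sv Su)
  where
  reversed : ∀ {u v} → adj G u v ≡ true → adj G v u ≡ true
  reversed {u} {v} uv = trans (adj-sym G v u) uv
  deg≡3 : ∀ {u v} → adj G u v ≡ true → S u ≡ true → S v ≡ true → deg G u ≡ 3
  deg≡3 {u} uv Su Sv = ≤-antisym (Δ≤3 u) (minMaxCut⇒3≤deg G minMax uv Su Sv)
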